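{- Let $(N_1,m_1)\vartriangleright_E(N_2,m_2)$, let $G=(V,R,A)$ be a well-formed Token Flow Graph for this equivalence, and let $c$ be a well-defined configuration of $G$. For a node $p$ let $\mathrm{succs}(p)=\{q\in V\mid p\to^\star q\}$. Then: (Forward) if $p,q$ are nodes with $c(p)\ne\bot$ and $p\to^\star q$, there is a well-defined configuration $c'$ with $c'(q)\ge c'(p)=c(p)$ and $c'(v)=c(v)$ for every node $v\notin\mathrm{succs}(p)$; (Backward) if $c(p)>0$, there is a root $v$ with $v\to^\star p$ and $c(v)>0$; (Agglomeration) if $p\circ\!\!\to\{q_1,\dots,q_k\}$ and $c(p)\ne\bot$, then for every $(l_1,\dots,l_k)\in\mathbb{N}^k$ with $c(p)=\sum_{i=1}^k l_i$ there is a well-defined configuration $c'$ with $c'(p)=c(p)$, $c'(q_i)=l_i$ for all $i\in 1..k$, and $c'(v)=c(v)$ for every node $v\notin\mathrm{succs}(p)$.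
   Context: Petri nets. A Petri net is $N=(P,T,\mathbf{pre},\mathbf{post})$ with finite disjoint sets of places $P$ and transitions $T$ and $\mathbf{pre},\mathbf{post}:T\to(P\to\mathbb{N})$. A marking is a map $m:P\to\mathbb{N}$. Transition $t$ is enabled at $m$ if $m(p)\ge\mathbf{pre}(t,p)$ for all $p$; firing it yields $m'=m-\mathbf{pre}(t)+\mathbf{post}(t)$. $R(N,m_0)$ is the set of markings reachable from $m_0$ by finite (possibly empty) sequences of firings. Equations. Solutions of a linear system $E$ (with variable set $\mathrm{fv}(E)$) are total non-negative integer assignments satisfying all equations; $E$ is consistent if it has one. Fix pairwise disjoint sets $K(n)$, $n\in\mathbb{N}$, of constant symbols (disjoint from place and variable names), $K=\bigcup_n K(n)$; a constant in $K(n)$ stands for $n$. Every equation of $E$ has the form $v=\sum_{x\in X}x$ with $X$ a nonempty finite set of variables and $v$ a variable or constant. For a partial map $m$ defined exactly on $x_1,\dots,x_k$, $\llbracket m\rrbracket$ is the system $x_1=m(x_1),\dots,x_k=m(x_k)$; commas denote union of systems. $E$-equivalence: $(N_1,m_1)\vartriangleright_E(N_2,m_2)$ iff (A1) $E,\llbracket m\rrbracket$ is consistent for every $m\in R(N_1,m_1)\cup R(N_2,m_2)$; (A2) $E,\llbracket m_1\rrbracket,\llbracket m_2\rrbracket$ is consistent; (A3) for all markings $m_1'$ of $N_1$, $m_2'$ of $N_2$ with $E,\llbracket m_1'\rrbracket,\llbracket m_2'\rrbracket$ consistent, $m_1'\in R(N_1,m_1)$ iff $m_2'\in R(N_2,m_2)$.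 Token Flow Graphs. A TFG is $(V,R,A)$ with $V=P\cup S$, $S\subset K$ finite, and disjoint $R,A\subseteq V\times V$. Write $v\to\!\bullet\, w$ for $(v,w)\in R$, $v\circ\!\!\to w$ for $(v,w)\in A$, $v\to w$ for either, and $\to^\star$ for the reflexive-transitive closure. A root is a node that is the target of no arc. $v\circ\!\!\to X$ means $X$ is the nonempty set of all $w$ with $v\circ\!\!\to w$; $X\to\!\bullet\, v$ means $X$ is the nonempty set of all $w$ with $w\to\!\bullet\, v$. The TFG is well-formed for $(N_1,m_1)\vartriangleright_E(N_2,m_2)$ (place sets $P_1,P_2$) if: (T1) $V\setminus K=P_1\cup P_2\cup\mathrm{fv}(E)$; (T2) nodes in $V\cap K$ are roots; (T3) one cannot have $p\circ\!\!\to q$ and $p'\to q$ with $p\ne p'$, nor both $p\to\!\bullet\, q$ and $p\circ\!\!\to q$; (T4) $v\circ\!\!\to X$ or $X\to\!\bullet\, v$ holds iff the equation $v=\sum_{x\in X}x$ is in $E$. Configurations. A configuration is a partial function $c:V\to\mathbb{N}$ ($c(v)=\bot$ when undefined) with $c(v)=n$ for all $v\in V\cap K(n)$. It is well-defined if (CBot) whenever $v\to w$, $c(v)=\bot$ iff $c(w)=\bot$; and (CEq) whenever $c(v)\ne\bot$ and ($v\circ\!\!\to X$ or $X\to\!\bullet\, v$), $c(v)=\sum_{x\in X}c(x)$. -}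

module Defs where

open import Data.Nat using (ℕ; zero; suc; _+_; _∸_; _≤_; _<_)
open import Data.Nat.Properties using () renaming (_≟_ to _≟ℕ_)
open import Data.Fin using (Fin)
open import Data.List using (List; []; _∷_; _++_; map)
open import Data.Nat.ListAction using (sum)
open import Data.List.Membership.Propositional using (_∈_; _∉_)
open import Data.List.Relation.Unary.Unique.Propositional using (Unique)
open import Data.Maybe using (Maybe; just; nothing)
open import Data.Product using (Σ; ∃; ∃-syntax; _×_; _,_)
open import Data.Sum using (_⊎_)
open import Data.Empty using (⊥)
open import Data.Unit using (⊤)
open import Function.Bundles using (_⇔_)
open import Function.Definitions using (Injective)
open import Relation.Nullary using (¬_; Dec; yes; no)
open import Relation.Binary.PropositionalEquality using (_≡_; _≢_; refl; cong)

-- A constant symbol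
-- `con n i` is the i-th constant of K(n); it stands for n.  So the sets
-- K(n) = { con n i | i ∈ ℕ } are pairwise disjoint and disjoint from names.

data Sym : Set where
  var : ℕ → Sym
  con : ℕ → ℕ → Sym

_≟S_ : (a b : Sym) → Dec (a ≡ b)
var x ≟S var y with x ≟ℕ y
... | yes refl = yes refl
... | no ne = no λ { refl → ne refl }
var x ≟S con n i = no λ ()
con n i ≟S var x = no λ ()
con n i ≟S con m j with n ≟ℕ m | i ≟ℕ j
... | yes refl | yes refl = yes refl
... | no ne | _ = no λ { refl → ne refl }
... | yes _ | no ne = no λ { refl → ne refl }

record Net : Set where
  field
    np nt : ℕ
    pre post : Fin nt → Fin np → ℕ
    place : Fin np → ℕ
    place-inj : Injective _≡_ _≡_ place
open Net public

Marking : Net → Set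
Marking N = Fin (np N) → ℕ

IsPlace : Net → ℕ → Set
IsPlace N x = ∃[ p ] place N p ≡ x

data Reach (N : Net) (m : Marking N) : Marking N → Set where
  base : ∀ {m'} → (∀ p → m' p ≡ m p) → Reach N m m'
  step : ∀ {m'' m'} (t : Fin (nt N)) → Reach N m m''
       → (∀ p → pre N t p ≤ m'' p)
       → (∀ p → m' p ≡ (m'' p ∸ pre N t p) + post N t p)
       → Reach N m m'

-- Linear systems: equations  v = Σ_{x ∈ X} x,  X a nonempty finite set of
-- variables (a duplicate-free nonempty list), v a variable or constant.

record Equation : Set where
  field
    lhs : Sym
    rhs : List ℕ
    rhs-unique : Unique rhs
    rhs-nonempty : rhs ≢ []
open Equation public

System : Set
System = List Equation

_∈fv_ : ℕ → System → Set
x ∈fv E = ∃[ e ] (e ∈ E × (lhs e ≡ var x ⊎ x ∈ rhs e))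

⟦_⟧S : Sym → (ℕ → ℕ) → ℕ
⟦ var x ⟧S σ = σ x
⟦ con n i ⟧S σ = n

Solves : (ℕ → ℕ) → System → Set
Solves σ E = ∀ e → e ∈ E → ⟦ lhs e ⟧S σ ≡ sum (map σ (rhs e))

SolvesM : (ℕ → ℕ) → (N : Net) → Marking N → Set
SolvesM σ N m = ∀ p → σ (place N p) ≡ m p

Consistent₁ : System → (N : Net) → Marking N → Set
Consistent₁ E N m = ∃[ σ ] (Solves σ E × SolvesM σ N m)

Consistent₂ : System → (N₁ : Net) → Marking N₁ → (N₂ : Net) → Marking N₂ → Set
Consistent₂ E N₁ m₁ N₂ m₂ = ∃[ σ ] (Solves σ E × SolvesM σ N₁ m₁ × SolvesM σ N₂ m₂)

record EEquiv (N₁ : Net) (m₁ : Marking N₁) (E : System)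
              (N₂ : Net) (m₂ : Marking N₂) : Set where
  field
    A1₁ : ∀ m → Reach N₁ m₁ m → Consistent₁ E N₁ m
    A1₂ : ∀ m → Reach N₂ m₂ m → Consistent₁ E N₂ m
    A2  : Consistent₂ E N₁ m₁ N₂ m₂
    A3  : ∀ (m₁' : Marking N₁) (m₂' : Marking N₂) → Consistent₂ E N₁ m₁' N₂ m₂'
        → (Reach N₁ m₁ m₁' ⇔ Reach N₂ m₂ m₂')

-- V = P ∪ S where P (non-constant nodes) is `names`
-- and S ⊂ K is given by `consts` ((n , i) ∈ consts means con n i ∈ S).
-- R (redundancy arcs) and A (agglomeration arcs) are finite sets of pairs,
-- represented by duplicate-free lists.

record TFG : Set where
  field
    names  : List ℕ
    consts : List (ℕ × ℕ)
    R A    : List (Sym × Sym)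
    R-unique : Unique R
    A-unique : Unique A
open TFG public

InV : TFG → Sym → Set
InV G (var x) = x ∈ names G
InV G (con n i) = (n , i) ∈ consts G

IsConst : Sym → Set
IsConst (var _) = ⊥
IsConst (con _ _) = ⊤

_⊢_→•_ : TFG → Sym → Sym → Set
G ⊢ v →• w = (v , w) ∈ R G

_⊢_∘→_ : TFG → Sym → Sym → Set
G ⊢ v ∘→ w = (v , w) ∈ A G

_⊢_⟶_ : TFG → Sym → Sym → Set
G ⊢ v ⟶ w = G ⊢ v →• w ⊎ G ⊢ v ∘→ w

data _⊢_⟶⋆_ (G : TFG) : Sym → Sym → Set where
  here  : ∀ {v} → G ⊢ v ⟶⋆ v
  there : ∀ {u v w} → G ⊢ u ⟶ v → G ⊢ v ⟶⋆ w → G ⊢ u ⟶⋆ w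

-- outs G v : the targets w with v ∘→ w  (the set X in v ∘→ X)
outs : List (Sym × Sym) → Sym → List Sym
outs [] v = []
outs ((a , b) ∷ as) v with a ≟S v
... | yes _ = b ∷ outs as v
... | no _  = outs as v

-- ins G v : the sources w with w →• v  (the set X in X →• v)
ins : List (Sym × Sym) → Sym → List Sym
ins [] v = []
ins ((a , b) ∷ as) v with b ≟S v
... | yes _ = a ∷ ins as v
... | no _  = ins as v

AOut : TFG → Sym → List Sym
AOut G v = outs (A G) v

RIn : TFG → Sym → List Sym
RIn G v = ins (R G) v

IsRoot : TFG → Sym → Set
IsRoot G v = InV G v × (∀ u → ¬ (G ⊢ u ⟶ v))

rhsNodes : Equation → List Sym
rhsNodes e = map var (rhs e)

SameSet : List Sym → List Sym → Set
SameSet xs ys = ∀ w → (w ∈ xs ⇔ w ∈ ys)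

record WellFormed (G : TFG) (N₁ N₂ : Net) (E : System) : Set where
  field
    arcs-in-V : ∀ v w → (v , w) ∈ (R G ++ A G) → InV G v × InV G w
    R-A-disjoint : ∀ v w → G ⊢ v →• w → ¬ (G ⊢ v ∘→ w)
    T1 : ∀ x → x ∈ names G ⇔ (IsPlace N₁ x ⊎ IsPlace N₂ x ⊎ x ∈fv E)
    T2 : ∀ v → InV G v → IsConst v → ∀ u → ¬ (G ⊢ u ⟶ v)
    T3a : ∀ p p' q → G ⊢ p ∘→ q → G ⊢ p' ⟶ q → p ≡ p'
    T3b : ∀ p q → G ⊢ p →• q → ¬ (G ⊢ p ∘→ q)
    T4-A : ∀ v → AOut G v ≢ []
         → ∃[ e ] (e ∈ E × lhs e ≡ v × SameSet (AOut G v) (rhsNodes e))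
    T4-R : ∀ v → RIn G v ≢ []
         → ∃[ e ] (e ∈ E × lhs e ≡ v × SameSet (RIn G v) (rhsNodes e))
    T4-E : ∀ e → e ∈ E
         → SameSet (AOut G (lhs e)) (rhsNodes e) ⊎ SameSet (RIn G (lhs e)) (rhsNodes e)

Acyclic : TFG → Set
Acyclic G = ∀ u v → G ⊢ u ⟶ v → ¬ (G ⊢ v ⟶⋆ u)

Config : Set
Config = Sym → Maybe ℕ

IsConfig : TFG → Config → Set
IsConfig G c = (∀ n i → (n , i) ∈ consts G → c (con n i) ≡ just n)
             × (∀ v → ¬ InV G v → c v ≡ nothing)

_+?_ : Maybe ℕ → Maybe ℕ → Maybe ℕ
just a +? just b = just (a + b)
_ +? _ = nothing

msum : Config → List Sym → Maybe ℕ
msum c [] = just 0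
msum c (w ∷ ws) = c w +? msum c ws

record WellDefined (G : TFG) (c : Config) : Set where
  field
    CBot : ∀ v w → G ⊢ v ⟶ w → (c v ≡ nothing ⇔ c w ≡ nothing)
    CEq-A : ∀ v k → c v ≡ just k → AOut G v ≢ [] → msum c (AOut G v) ≡ just k
    CEq-R : ∀ v k → c v ≡ just k → RIn G v ≢ [] → msum c (RIn G v) ≡ just k

{-# OPTIONS --safe #-}
module Submission where

-- Acyclicity makes the parent relation of a finite TFG well-founded, so one can
-- argue and define by recursion from the roots down.  Backward: a positive node's
-- A-parent holds at least its value, and one of its R-parents is positive, so
-- walking up ends at a positive root.  Agglomeration: keep c off succs(p), put k
-- on p and l on its A-children, and recompute the rest of succs(p) from the
-- parents, an R-node as the sum of its R-parents and an A-node by giving the whole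
-- value of its (unique, by T3) A-parent to that parent's first A-child; T3 also
-- ensures no node is both an R- and an A-target, so every equation of (CEq) is
-- preserved.  Forward: follow the path from p to q; across an R-arc the value can
-- only grow, and across an A-arc agglomeration moves all of it to the next node.

open import Defs
open import Data.Empty using (⊥-elim)
open import Data.List using (List; []; _∷_; _++_; map)
open import Data.List.Membership.Propositional using (_∈_; _∉_; mapWith∈)
open import Data.List.Membership.Propositional.Properties using (mapWith∈-cong; mapWith∈≗map; ∈-++⁺ˡ; ∈-++⁺ʳ; ∈-++⁻)
open import Data.List.Properties using (map-cong-local)
import Data.List.Relation.Unary.All as All
open import Data.List.Relation.Unary.AllPairs using ([]; _∷_)
open import Data.List.Relation.Unary.Any using (here; there; any?)
open import Data.List.Relation.Unary.Unique.Propositional using (Unique)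
open import Data.Maybe using (Maybe; just; nothing; fromMaybe)
import Data.Maybe as Maybe
open import Data.Maybe.Properties using (map-just)
open import Data.Nat using (ℕ; zero; suc; _+_; _≤_; _<_; z≤n; s≤s)
open import Data.Nat.ListAction using (sum)
open import Data.Nat.Properties using (≤-refl; ≤-trans; <-≤-trans; m≤m+n; m≤n+m; +-identityʳ)
  renaming (_≟_ to _≟ℕ_)
open import Data.Product using (∃-syntax; _×_; _,_; proj₁; proj₂)
open import Data.Product.Properties using (≡-dec)
open import Data.Sum using (_⊎_; inj₁; inj₂)
open import Data.Unit using (tt)
open import Function using (_∘_)
open import Function.Bundles using (_⇔_; mk⇔; Equivalence)
import Function.Properties.Equivalence as ⇔
open import Induction.WellFounded using (Acc; acc; WellFounded; WfRec; module Subrelation)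
import Induction.WellFounded as WF
open import Level using (0ℓ)
open import Relation.Nullary using (¬_; Dec; yes; no)
open import Relation.Nullary.Decidable using (_⊎-dec_; map′)
open import Relation.Binary.PropositionalEquality
  using (_≡_; _≢_; refl; sym; trans; cong; cong₂; subst; subst₂; module ≡-Reasoning)

sum-cong : ∀ {A : Set} {f g : A → ℕ} xs → (∀ {x} → x ∈ xs → f x ≡ g x) →
           sum (map f xs) ≡ sum (map g xs)
sum-cong xs eq = cong sum (map-cong-local (All.tabulate eq))

≤-sum : ∀ {A : Set} (f : A → ℕ) {x} xs → x ∈ xs → f x ≤ sum (map f xs)
≤-sum f (x ∷ xs) (here refl)  = m≤m+n (f x) _
≤-sum f (y ∷ xs) (there x∈xs) = ≤-trans (≤-sum f xs x∈xs) (m≤n+m _ (f y))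

sum-pos : ∀ {A : Set} (f : A → ℕ) xs → 0 < sum (map f xs) → ∃[ x ] (x ∈ xs × 0 < f x)
sum-pos f (x ∷ xs) pos with f x in fx
... | suc _ = x , here refl , subst (0 <_) (sym fx) (s≤s z≤n)
... | zero with sum-pos f xs pos
...   | y , y∈xs , fy = y , there y∈xs , fy

≢[]⇒∈ : ∀ {A : Set} {xs : List A} → xs ≢ [] → ∃[ x ] (x ∈ xs)
≢[]⇒∈ {xs = []}    xs≢[] = ⊥-elim (xs≢[] refl)
≢[]⇒∈ {xs = x ∷ _} _     = x , here refl

∈⇒≢[] : ∀ {A : Set} {x} {xs : List A} → x ∈ xs → xs ≢ []
∈⇒≢[] () refl

point : Sym → ℕ → Sym → ℕ
point r n w with r ≟S w
... | yes _ = n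
... | no _  = 0

point-self : ∀ r n → point r n r ≡ n
point-self r n with r ≟S r
... | yes _   = refl
... | no r≢r = ⊥-elim (r≢r refl)

sum-point-∉ : ∀ {r} n xs → r ∉ xs → sum (map (point r n) xs) ≡ 0
sum-point-∉ n []       r∉xs = refl
sum-point-∉ {r} n (x ∷ xs) r∉xs with r ≟S x
... | yes r≡x = ⊥-elim (r∉xs (here r≡x))
... | no _    = sum-point-∉ n xs (r∉xs ∘ there)

sum-point-∈ : ∀ {r} n {xs} → Unique xs → r ∈ xs → sum (map (point r n) xs) ≡ n
sum-point-∈ {r} n {r ∷ xs} (r∉xs ∷ _) (here refl) =
  trans (cong₂ _+_ (point-self r n) (sum-point-∉ n xs λ r∈xs → All.lookup r∉xs r∈xs refl))
        (+-identityʳ n)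
sum-point-∈ {r} n {x ∷ xs} (x∉xs ∷ u) (there r∈xs) with r ≟S x
... | yes refl = ⊥-elim (All.lookup x∉xs r∈xs refl)
... | no _     = sum-point-∈ n u r∈xs

onHead : List Sym → ℕ → Sym → ℕ
onHead []      n _ = 0
onHead (h ∷ _) n   = point h n

sum-onHead : ∀ n {xs} → Unique xs → xs ≢ [] → sum (map (onHead xs n) xs) ≡ n
sum-onHead n {[]}    _ []≢[] = ⊥-elim ([]≢[] refl)
sum-onHead n {h ∷ _} u _     = sum-point-∈ n u (here refl)

∈-outs⁻ : ∀ as {v w} → w ∈ outs as v → (v , w) ∈ as
∈-outs⁻ ((a , b) ∷ as) {v} w∈ with a ≟S v | w∈
... | yes refl | here refl = here refl
... | yes refl | there w∈' = there (∈-outs⁻ as w∈')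
... | no _     | w∈'       = there (∈-outs⁻ as w∈')

∈-outs⁺ : ∀ as {v w} → (v , w) ∈ as → w ∈ outs as v
∈-outs⁺ ((a , b) ∷ as) {v} vw∈ with a ≟S v | vw∈
... | yes refl | here refl  = here refl
... | yes refl | there vw∈' = there (∈-outs⁺ as vw∈')
... | no a≢v   | here refl  = ⊥-elim (a≢v refl)
... | no _     | there vw∈' = ∈-outs⁺ as vw∈'

∈-ins⁻ : ∀ as {v w} → w ∈ ins as v → (w , v) ∈ as
∈-ins⁻ ((a , b) ∷ as) {v} w∈ with b ≟S v | w∈
... | yes refl | here refl = here refl
... | yes refl | there w∈' = there (∈-ins⁻ as w∈')
... | no _     | w∈'       = there (∈-ins⁻ as w∈')

∈-ins⁺ : ∀ as {v w} → (w , v) ∈ as → w ∈ ins as v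
∈-ins⁺ ((a , b) ∷ as) {v} wv∈ with b ≟S v | wv∈
... | yes refl | here refl  = here refl
... | yes refl | there wv∈' = there (∈-ins⁺ as wv∈')
... | no b≢v   | here refl  = ⊥-elim (b≢v refl)
... | no _     | there wv∈' = ∈-ins⁺ as wv∈'

outs-unique : ∀ as v → Unique as → Unique (outs as v)
outs-unique []             v _           = []
outs-unique ((a , b) ∷ as) v (ab∉ ∷ u) with a ≟S v
... | yes refl = All.tabulate (λ w∈ b≡w → All.lookup ab∉ (∈-outs⁻ as w∈) (cong (a ,_) b≡w))
               ∷ outs-unique as v u
... | no _     = outs-unique as v u

source? : ∀ {P : Sym → Set} as w → (∀ {y} → (y , w) ∈ as → Dec (P y)) →
          Dec (∃[ y ] ((y , w) ∈ as × P y))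
source? []             w P? = no λ ()
source? ((a , b) ∷ as) w P? with source? as w (P? ∘ there) | b ≟S w
... | yes (y , yw∈ , Py) | _        = yes (y , there yw∈ , Py)
... | no none            | no b≢w   = no λ { (_ , here refl , _)   → b≢w refl
                                           ; (y , there yw∈ , Py) → none (y , yw∈ , Py) }
... | no none            | yes refl with P? (here refl)
...   | yes Pa  = yes (a , here refl , Pa)
...   | no ¬Pa = no λ { (_ , here refl , Py)   → ¬Pa Py
                       ; (y , there yw∈ , Py) → none (y , yw∈ , Py) }

InV? : ∀ G v → Dec (InV G v)
InV? G (var x)   = any? (x ≟ℕ_) (names G)
InV? G (con n i) = any? (≡-dec _≟ℕ_ _≟ℕ_ (n , i)) (consts G)

value₀ : Config → Sym → ℕ
value₀ c v = fromMaybe 0 (c v)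

value₀-just : ∀ {c : Config} {v n} → c v ≡ just n → value₀ c v ≡ n
value₀-just cv = cong (fromMaybe 0) cv

msum≡just⇒sum : ∀ c xs {n} → msum c xs ≡ just n → sum (map (value₀ c) xs) ≡ n
msum≡just⇒sum c []       refl = refl
msum≡just⇒sum c (x ∷ xs) eq with c x | msum c xs in rest | eq
... | just a | just b | refl = cong (a +_) (msum≡just⇒sum c xs rest)

msum-just : ∀ c (g : Sym → ℕ) xs → (∀ {x} → x ∈ xs → c x ≡ just (g x)) →
            msum c xs ≡ just (sum (map g xs))
msum-just c g []       _  = refl
msum-just c g (x ∷ xs) cg rewrite cg (here refl) | msum-just c g xs (cg ∘ there) = refl

≢nothing⇒just : ∀ {A : Set} {m : Maybe A} → m ≢ nothing → ∃[ a ] (m ≡ just a)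
≢nothing⇒just {m = just a}  _  = a , refl
≢nothing⇒just {m = nothing} ≢n = ⊥-elim (≢n refl)

just≢nothing : ∀ {A : Set} {m : Maybe A} {a} → m ≡ just a → m ≢ nothing
just≢nothing refl ()

config⇒InV : ∀ {G c v n} → IsConfig G c → c v ≡ just n → InV G v
config⇒InV {G} {v = v} (_ , outside-V) cv with InV? G v
... | yes v∈V  = v∈V
... | no v∉V = ⊥-elim (just≢nothing cv (outside-V v v∉V))

map-just⁻ : ∀ {A B : Set} {f : A → B} {b} (m : Maybe A) →
            Maybe.map f m ≡ just b → ∃[ a ] (m ≡ just a × f a ≡ b)
map-just⁻ (just a) refl = a , refl , refl

map-≡nothing⇔ : ∀ {A B : Set} {f : A → B} (m : Maybe A) → Maybe.map f m ≡ nothing ⇔ m ≡ nothing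
map-≡nothing⇔ nothing  = mk⇔ (λ _ → refl) (λ _ → refl)
map-≡nothing⇔ (just _) = mk⇔ (λ ()) (λ ())

map-const-fromMaybe : ∀ (m : Maybe ℕ) → Maybe.map (λ _ → fromMaybe 0 m) m ≡ m
map-const-fromMaybe nothing  = refl
map-const-fromMaybe (just _) = refl

-- Paths and well-foundedness

module _ {G : TFG} where

  ⟶⋆-snoc : ∀ {u v w} → G ⊢ u ⟶⋆ v → G ⊢ v ⟶ w → G ⊢ u ⟶⋆ w
  ⟶⋆-snoc here        vw = there vw here
  ⟶⋆-snoc (there a s) vw = there a (⟶⋆-snoc s vw)

  ⟶⋆-unsnoc : ∀ {u w} → G ⊢ u ⟶⋆ w → u ≡ w ⊎ ∃[ v ] (G ⊢ u ⟶⋆ v × G ⊢ v ⟶ w)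
  ⟶⋆-unsnoc here = inj₁ refl
  ⟶⋆-unsnoc (there uv s) with ⟶⋆-unsnoc s
  ... | inj₁ refl           = inj₂ (_ , here , uv)
  ... | inj₂ (v , s' , vw) = inj₂ (v , there uv s' , vw)

module _ {G : TFG} (acyclic : Acyclic G) where

  -- A descending chain uses a new arc (x , y) at most once: afterwards it
  -- stays among the ancestors of x, and y is not one of them.
  acc-arcs : ∀ as → (∀ {x w} → (x , w) ∈ as → G ⊢ x ⟶ w) →
             ∀ w → Acc (λ x w → (x , w) ∈ as) w
  acc-arcs []             _   w = acc λ ()
  acc-arcs ((x , y) ∷ as) arc w = extend w (acc-arcs as (arc ∘ there) w)
    where
    _⇢_ : Sym → Sym → Set
    a ⇢ b = (a , b) ∈ (x , y) ∷ as

    ancestor : ∀ v → Acc (λ a b → (a , b) ∈ as) v → G ⊢ v ⟶⋆ x → Acc _⇢_ v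
    ancestor v (acc rs) v⟶⋆x = acc λ where
      (here refl) → ⊥-elim (acyclic x y (arc (here refl)) v⟶⋆x)
      (there uv)  → ancestor _ (rs uv) (there (arc (there uv)) v⟶⋆x)

    extend : ∀ v → Acc (λ a b → (a , b) ∈ as) v → Acc _⇢_ v
    extend v (acc rs) = acc λ where
      (here refl) → ancestor x (acc-arcs as (arc ∘ there) x) here
      (there uv)  → extend _ (rs uv)

  ⟶-wellFounded : WellFounded (λ y w → G ⊢ y ⟶ w)
  ⟶-wellFounded = Subrelation.wellFounded toArcs (acc-arcs (R G ++ A G) fromArcs)
    where
    toArcs : ∀ {y w} → G ⊢ y ⟶ w → (y , w) ∈ R G ++ A G
    toArcs (inj₁ b) = ∈-++⁺ˡ b
    toArcs (inj₂ a) = ∈-++⁺ʳ (R G) a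

    fromArcs : ∀ {y w} → (y , w) ∈ R G ++ A G → G ⊢ y ⟶ w
    fromArcs = ∈-++⁻ (R G)

  reachable? : ∀ p w → Dec (G ⊢ p ⟶⋆ w)
  reachable? p = WF.All.wfRec ⟶-wellFounded 0ℓ (λ w → Dec (G ⊢ p ⟶⋆ w)) decide
    where
    decide : ∀ w → WfRec (λ y w → G ⊢ y ⟶ w) (λ w → Dec (G ⊢ p ⟶⋆ w)) w → Dec (G ⊢ p ⟶⋆ w)
    decide w rec with p ≟S w
    ... | yes refl = yes here
    ... | no p≢w   = map′ throughParent lastArc
                          (source? (R G) w (rec ∘ inj₁) ⊎-dec source? (A G) w (rec ∘ inj₂))
      where
      ReachedParent : List (Sym × Sym) → Set
      ReachedParent as = ∃[ y ] ((y , w) ∈ as × G ⊢ p ⟶⋆ y)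

      throughParent : ReachedParent (R G) ⊎ ReachedParent (A G) → G ⊢ p ⟶⋆ w
      throughParent (inj₁ (_ , b , s)) = ⟶⋆-snoc s (inj₁ b)
      throughParent (inj₂ (_ , a , s)) = ⟶⋆-snoc s (inj₂ a)

      lastArc : G ⊢ p ⟶⋆ w → ReachedParent (R G) ⊎ ReachedParent (A G)
      lastArc s with ⟶⋆-unsnoc s
      ... | inj₁ p≡w                = ⊥-elim (p≢w p≡w)
      ... | inj₂ (y , s' , inj₁ b) = inj₁ (y , b , s')
      ... | inj₂ (y , s' , inj₂ a) = inj₂ (y , a , s')

module WellDefinedConfig {G : TFG} {c : Config} (wd : WellDefined G c) where
  open WellDefined wd

  defined-child : ∀ {v w i} → G ⊢ v ⟶ w → c v ≡ just i → ∃[ j ] (c w ≡ just j)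
  defined-child {v} {w} vw cv =
    ≢nothing⇒just λ cw → just≢nothing cv (Equivalence.from (CBot v w vw) cw)

  defined-parent : ∀ {v w j} → G ⊢ v ⟶ w → c w ≡ just j → ∃[ i ] (c v ≡ just i)
  defined-parent {v} {w} vw cw =
    ≢nothing⇒just λ cv → just≢nothing cw (Equivalence.to (CBot v w vw) cv)

  sum-AOut : ∀ {v n} → c v ≡ just n → AOut G v ≢ [] → sum (map (value₀ c) (AOut G v)) ≡ n
  sum-AOut {v} {n} cv ne = msum≡just⇒sum c (AOut G v) (CEq-A v n cv ne)

  sum-RIn : ∀ {v n} → c v ≡ just n → RIn G v ≢ [] → sum (map (value₀ c) (RIn G v)) ≡ n
  sum-RIn {v} {n} cv ne = msum≡just⇒sum c (RIn G v) (CEq-R v n cv ne)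

  A-child-≤ : ∀ {v w m n} → G ⊢ v ∘→ w → c v ≡ just n → c w ≡ just m → m ≤ n
  A-child-≤ {v} vw cv cw = subst₂ _≤_ (value₀-just {c} cw) (sum-AOut cv (∈⇒≢[] w∈))
                                   (≤-sum (value₀ c) (AOut G v) w∈)
    where w∈ = ∈-outs⁺ (A G) vw

  R-parent-≤ : ∀ {v w m n} → G ⊢ v →• w → c v ≡ just m → c w ≡ just n → m ≤ n
  R-parent-≤ {w = w} vw cv cw = subst₂ _≤_ (value₀-just {c} cv) (sum-RIn cw (∈⇒≢[] v∈))
                                       (≤-sum (value₀ c) (RIn G w) v∈)
    where v∈ = ∈-ins⁺ (R G) vw

  positive-R-parent : ∀ {y w n} → G ⊢ y →• w → c w ≡ just n → 0 < n →
                      ∃[ x ] (G ⊢ x →• w × ∃[ j ] (c x ≡ just j × 0 < j))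
  positive-R-parent {w = w} yw cw pos
    with sum-pos (value₀ c) (RIn G w) (subst (0 <_) (sym (sum-RIn cw (∈⇒≢[] (∈-ins⁺ (R G) yw)))) pos)
  ... | x , x∈ , posx with defined-parent (inj₁ (∈-ins⁻ (R G) x∈)) cw
  ...   | _ , cx = x , ∈-ins⁻ (R G) x∈ , _ , cx , subst (0 <_) (value₀-just {c} cx) posx

-- Backward

module _ {G : TFG} {c : Config} (isConfig : IsConfig G c) (wd : WellDefined G c) where
  open WellDefinedConfig wd

  FedByPositiveRoot : Sym → Set
  FedByPositiveRoot p = ∃[ v ] (IsRoot G v × G ⊢ v ⟶⋆ p × ∃[ j ] (c v ≡ just j × 0 < j))

  fed-through : ∀ {y p} → G ⊢ y ⟶ p → FedByPositiveRoot y → FedByPositiveRoot p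
  fed-through yp (v , root , s , positive) = v , root , ⟶⋆-snoc s yp , positive

  positive⇒fedByRoot : ∀ {p k} → Acc (λ y w → G ⊢ y ⟶ w) p → c p ≡ just k → 0 < k →
                       FedByPositiveRoot p
  positive⇒fedByRoot {p} (acc rs) cp pos with source? (A G) p (λ _ → yes tt)
  ... | yes (x , xp , _) with defined-parent (inj₂ xp) cp
  ...   | _ , cx = fed-through (inj₂ xp)
                     (positive⇒fedByRoot (rs (inj₂ xp)) cx (<-≤-trans pos (A-child-≤ xp cx cp)))
  positive⇒fedByRoot {p} (acc rs) cp pos | no noA with source? (R G) p (λ _ → yes tt)
  ... | yes (_ , yp , _) with positive-R-parent yp cp pos
  ...   | x , xp , _ , cx , posx = fed-through (inj₁ xp) (positive⇒fedByRoot (rs (inj₁ xp)) cx posx)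
  positive⇒fedByRoot {p} _ cp pos | no noA | no noR =
    p , (config⇒InV isConfig cp , noParent) , here , _ , cp , pos
    where
    noParent : ∀ u → ¬ (G ⊢ u ⟶ p)
    noParent u (inj₁ up) = noR (u , up , tt)
    noParent u (inj₂ up) = noA (u , up , tt)

-- Agglomeration

AgreeOffSuccs : TFG → Sym → Config → Config → Set
AgreeOffSuccs G p c′ c = ∀ v → InV G v → ¬ (G ⊢ p ⟶⋆ v) → c′ v ≡ c v

module Agglomeration
  (G : TFG) (acyclic : Acyclic G)
  (T2  : ∀ v → InV G v → IsConst v → ∀ u → ¬ (G ⊢ u ⟶ v))
  (T3a : ∀ p p' q → G ⊢ p ∘→ q → G ⊢ p' ⟶ q → p ≡ p')
  (T3b : ∀ p q → G ⊢ p →• q → ¬ (G ⊢ p ∘→ q))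
  {c : Config} (isConfig : IsConfig G c) (wd : WellDefined G c)
  {p : Sym} {k : ℕ} (cp : c p ≡ just k)
  (l : Sym → ℕ) (sum-l : sum (map l (AOut G p)) ≡ k)
  where

  open WellDefinedConfig wd

  R-parent⇒¬A-parent : ∀ {x y w} → G ⊢ y →• w → ¬ (G ⊢ x ∘→ w)
  R-parent⇒¬A-parent {x} {y} {w} yw xw with T3a x y w xw (inj₁ yw)
  ... | refl = T3b x w yw xw

  Unchanged : Sym → Set
  Unchanged w = w ≡ p ⊎ ¬ (G ⊢ p ⟶⋆ w)

  unchanged-if-no-reached-parent : ∀ {w} → (∀ {y} → G ⊢ p ⟶⋆ y → ¬ (G ⊢ y ⟶ w)) → Unchanged w
  unchanged-if-no-reached-parent {w} noParent with reachable? acyclic p w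
  ... | no ¬p⟶⋆w = inj₂ ¬p⟶⋆w
  ... | yes p⟶⋆w with ⟶⋆-unsnoc p⟶⋆w
  ...   | inj₁ p≡w            = inj₁ (sym p≡w)
  ...   | inj₂ (_ , s , yw) = ⊥-elim (noParent s yw)

  parent-unchanged : ∀ {y w} → G ⊢ y ⟶ w → Unchanged w → ¬ (G ⊢ p ⟶⋆ y)
  parent-unchanged yw (inj₁ refl) = acyclic _ p yw
  parent-unchanged yw (inj₂ ¬p⟶⋆w) p⟶⋆y = ¬p⟶⋆w (⟶⋆-snoc p⟶⋆y yw)

  A-child-unchanged : ∀ {v w} → G ⊢ v ∘→ w → ¬ (G ⊢ p ⟶⋆ v) → Unchanged w
  A-child-unchanged {v} {w} vw ¬p⟶⋆v = unchanged-if-no-reached-parent λ {y} p⟶⋆y yw →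
    ¬p⟶⋆v (subst (G ⊢ p ⟶⋆_) (sym (T3a v y w vw yw)) p⟶⋆y)

  root-unchanged : ∀ {w} → (∀ u → ¬ (G ⊢ u ⟶ w)) → Unchanged w
  root-unchanged noParent = unchanged-if-no-reached-parent λ {y} _ → noParent y

  data Position (w : Sym) : Set where
    source  : w ≡ p → Position w
    target  : G ⊢ p ∘→ w → Position w
    outside : ¬ (G ⊢ p ⟶⋆ w) → Position w
    below   : ∀ {y} → ¬ (G ⊢ p ∘→ w) → G ⊢ p ⟶⋆ y → G ⊢ y ⟶ w → Position w

  position : ∀ w → Position w
  position w with w ≟S p | any? (≡-dec _≟S_ _≟S_ (p , w)) (A G) | reachable? acyclic p w
  ... | yes w≡p | _      | _         = source w≡p
  ... | no _    | yes pw | _         = target pw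
  ... | no _    | no _   | no ¬p⟶⋆w = outside ¬p⟶⋆w
  ... | no w≢p  | no ¬pw | yes p⟶⋆w with ⟶⋆-unsnoc p⟶⋆w
  ...   | inj₁ p≡w            = ⊥-elim (w≢p (sym p≡w))
  ...   | inj₂ (_ , s , yw) = below ¬pw s yw

  ParentValues : Sym → Set
  ParentValues w = WfRec (λ y w → G ⊢ y ⟶ w) (λ _ → ℕ) w

  value : ∀ w → Position w → ParentValues w → ℕ
  value w (source _)               _ = k
  value w (target _)               _ = l w
  value w (outside _)              _ = value₀ c w
  value w (below _ _ (inj₁ _))     d = sum (mapWith∈ (RIn G w) (d ∘ inj₁ ∘ ∈-ins⁻ (R G)))
  value w (below {x} _ _ (inj₂ xw)) d = onHead (AOut G x) (d (inj₂ xw)) w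

  value-ext : ∀ w (π : Position w) {d d′ : ParentValues w} →
              (∀ {y} (yw : G ⊢ y ⟶ w) → d yw ≡ d′ yw) → value w π d ≡ value w π d′
  value-ext w (source _)               _  = refl
  value-ext w (target _)               _  = refl
  value-ext w (outside _)              _  = refl
  value-ext w (below _ _ (inj₁ _))     eq =
    cong sum (mapWith∈-cong (RIn G w) _ _ (eq ∘ inj₁ ∘ ∈-ins⁻ (R G)))
  value-ext w (below {x} _ _ (inj₂ xw)) eq = cong (λ n → onHead (AOut G x) n w) (eq (inj₂ xw))

  d : Sym → ℕ
  d = WF.All.wfRec (⟶-wellFounded acyclic) 0ℓ (λ _ → ℕ) (λ w → value w (position w))

  d-unfold : ∀ w → d w ≡ value w (position w) (λ {y} _ → d y)
  d-unfold w = WF.FixPoint.unfold-wfRec (⟶-wellFounded acyclic) (λ _ → ℕ)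
                 (λ w → value w (position w)) (λ w → value-ext w (position w)) {w}

  valueᵈ : ∀ {w} → Position w → ℕ
  valueᵈ {w} π = value w π (λ {y} _ → d y)

  d-source : d p ≡ k
  d-source = trans (d-unfold p) (at (position p))
    where
    at : (π : Position p) → valueᵈ π ≡ k
    at (source _)      = refl
    at (target pp)     = ⊥-elim (acyclic p p (inj₂ pp) here)
    at (outside ¬p⟶⋆p) = ⊥-elim (¬p⟶⋆p here)
    at (below _ s yp)  = ⊥-elim (acyclic _ p yp s)

  d-target : ∀ {q} → G ⊢ p ∘→ q → d q ≡ l q
  d-target {q} pq = trans (d-unfold q) (at (position q))
    where
    at : (π : Position q) → valueᵈ π ≡ l q
    at (source refl)   = ⊥-elim (acyclic p p (inj₂ pq) here)
    at (target _)      = refl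
    at (outside ¬p⟶⋆q) = ⊥-elim (¬p⟶⋆q (there (inj₂ pq) here))
    at (below ¬pq _ _) = ⊥-elim (¬pq pq)

  d-outside : ∀ {w} → ¬ (G ⊢ p ⟶⋆ w) → d w ≡ value₀ c w
  d-outside {w} ¬p⟶⋆w = trans (d-unfold w) (at (position w))
    where
    at : (π : Position w) → valueᵈ π ≡ value₀ c w
    at (source refl)  = ⊥-elim (¬p⟶⋆w here)
    at (target pw)    = ⊥-elim (¬p⟶⋆w (there (inj₂ pw) here))
    at (outside _)    = refl
    at (below _ s yw) = ⊥-elim (¬p⟶⋆w (⟶⋆-snoc s yw))

  d-below-A : ∀ {x w} → G ⊢ x ∘→ w → x ≢ p → G ⊢ p ⟶⋆ x → d w ≡ onHead (AOut G x) (d x) w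
  d-below-A {x} {w} xw x≢p p⟶⋆x = trans (d-unfold w) (at (position w))
    where
    at : (π : Position w) → valueᵈ π ≡ onHead (AOut G x) (d x) w
    at (source refl)   = ⊥-elim (acyclic x p (inj₂ xw) p⟶⋆x)
    at (target pw)     = ⊥-elim (x≢p (T3a x p w xw (inj₂ pw)))
    at (outside ¬p⟶⋆w) = ⊥-elim (¬p⟶⋆w (⟶⋆-snoc p⟶⋆x (inj₂ xw)))
    at (below _ _ (inj₁ yw)) = ⊥-elim (R-parent⇒¬A-parent yw xw)
    at (below {y} _ _ (inj₂ yw)) with T3a x y w xw (inj₂ yw)
    ... | refl = refl

  d-below-R : ∀ {y w} → G ⊢ y →• w → w ≢ p → G ⊢ p ⟶⋆ w → d w ≡ sum (map d (RIn G w))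
  d-below-R {y} {w} yw w≢p p⟶⋆w = trans (d-unfold w) (at (position w))
    where
    at : (π : Position w) → valueᵈ π ≡ sum (map d (RIn G w))
    at (source w≡p)          = ⊥-elim (w≢p w≡p)
    at (target pw)           = ⊥-elim (R-parent⇒¬A-parent yw pw)
    at (outside ¬p⟶⋆w)       = ⊥-elim (¬p⟶⋆w p⟶⋆w)
    at (below _ _ (inj₁ _))  = cong sum (mapWith∈≗map d (RIn G w))
    at (below _ _ (inj₂ xw)) = ⊥-elim (R-parent⇒¬A-parent yw xw)

  d-unchanged : ∀ {w} → Unchanged w → d w ≡ value₀ c w
  d-unchanged (inj₁ refl)     = trans d-source (sym (value₀-just {c} cp))
  d-unchanged (inj₂ ¬p⟶⋆w) = d-outside ¬p⟶⋆w

  region : ∀ v → Unchanged v ⊎ (v ≢ p × G ⊢ p ⟶⋆ v)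
  region v with v ≟S p | reachable? acyclic p v
  ... | yes v≡p | _          = inj₁ (inj₁ v≡p)
  ... | no _    | no ¬p⟶⋆v  = inj₁ (inj₂ ¬p⟶⋆v)
  ... | no v≢p  | yes p⟶⋆v = inj₂ (v≢p , p⟶⋆v)

  sum-d-AOut : ∀ {v i} → c v ≡ just i → AOut G v ≢ [] → sum (map d (AOut G v)) ≡ d v
  sum-d-AOut {v} {i} cv ne with region v
  ... | inj₁ (inj₁ refl) = begin
    sum (map d (AOut G p))  ≡⟨ sum-cong (AOut G p) (d-target ∘ ∈-outs⁻ (A G)) ⟩
    sum (map l (AOut G p))  ≡⟨ sum-l ⟩
    k                       ≡⟨ d-source ⟨
    d p                     ∎
    where open ≡-Reasoning
  ... | inj₁ (inj₂ ¬p⟶⋆v) = begin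
    sum (map d (AOut G v))          ≡⟨ sum-cong (AOut G v) (λ w∈ → d-unchanged
                                         (A-child-unchanged (∈-outs⁻ (A G) w∈) ¬p⟶⋆v)) ⟩
    sum (map (value₀ c) (AOut G v)) ≡⟨ sum-AOut cv ne ⟩
    i                               ≡⟨ value₀-just {c} cv ⟨
    value₀ c v                      ≡⟨ d-outside ¬p⟶⋆v ⟨
    d v                             ∎
    where open ≡-Reasoning
  ... | inj₂ (v≢p , p⟶⋆v) =
    trans (sum-cong (AOut G v) (λ w∈ → d-below-A (∈-outs⁻ (A G) w∈) v≢p p⟶⋆v))
          (sum-onHead (d v) (outs-unique (A G) v (A-unique G)) ne)

  sum-d-RIn-unchanged : ∀ {v i} → Unchanged v → c v ≡ just i → RIn G v ≢ [] →
                        sum (map d (RIn G v)) ≡ d v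
  sum-d-RIn-unchanged {v} {i} u cv ne = begin
    sum (map d (RIn G v))          ≡⟨ sum-cong (RIn G v) (λ y∈ → d-unchanged
                                        (inj₂ (parent-unchanged (inj₁ (∈-ins⁻ (R G) y∈)) u))) ⟩
    sum (map (value₀ c) (RIn G v)) ≡⟨ sum-RIn cv ne ⟩
    i                              ≡⟨ value₀-just {c} cv ⟨
    value₀ c v                     ≡⟨ d-unchanged u ⟨
    d v                            ∎
    where open ≡-Reasoning

  sum-d-RIn : ∀ {v i} → c v ≡ just i → RIn G v ≢ [] → sum (map d (RIn G v)) ≡ d v
  sum-d-RIn {v} cv ne with region v
  ... | inj₁ u = sum-d-RIn-unchanged u cv ne
  ... | inj₂ (v≢p , p⟶⋆v) with ≢[]⇒∈ ne
  ...   | _ , y∈ = sym (d-below-R (∈-ins⁻ (R G) y∈) v≢p p⟶⋆v)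

  c′ : Config
  c′ w = Maybe.map (λ _ → d w) (c w)

  c′-just : ∀ {w i} → c w ≡ just i → c′ w ≡ just (d w)
  c′-just = map-just

  c′-unchanged : ∀ {w} → d w ≡ value₀ c w → c′ w ≡ c w
  c′-unchanged {w} dw =
    trans (cong (λ n → Maybe.map (λ _ → n) (c w)) dw) (map-const-fromMaybe (c w))

  c′-isConfig : IsConfig G c′
  c′-isConfig = constants , outside-V
    where
    constants : ∀ n i → (n , i) ∈ consts G → c′ (con n i) ≡ just n
    constants n i ni∈ = trans (c′-unchanged (d-unchanged (root-unchanged (T2 (con n i) ni∈ tt))))
                              (proj₁ isConfig n i ni∈)
    outside-V : ∀ v → ¬ InV G v → c′ v ≡ nothing
    outside-V v v∉V = Equivalence.from (map-≡nothing⇔ (c v)) (proj₂ isConfig v v∉V)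

  c′-wellDefined : WellDefined G c′
  c′-wellDefined = record { CBot = CBot ; CEq-A = CEq-A ; CEq-R = CEq-R }
    where
    CBot : ∀ v w → G ⊢ v ⟶ w → (c′ v ≡ nothing ⇔ c′ w ≡ nothing)
    CBot v w vw = ⇔.trans (map-≡nothing⇔ (c v))
                    (⇔.trans (WellDefined.CBot wd v w vw) (⇔.sym (map-≡nothing⇔ (c w))))

    CEq-A : ∀ v j → c′ v ≡ just j → AOut G v ≢ [] → msum c′ (AOut G v) ≡ just j
    CEq-A v j c′v ne with map-just⁻ (c v) c′v
    ... | _ , cv , refl = trans (msum-just c′ d (AOut G v) defined) (cong just (sum-d-AOut cv ne))
      where
      defined : ∀ {w} → w ∈ AOut G v → c′ w ≡ just (d w)
      defined w∈ = c′-just (proj₂ (defined-child (inj₂ (∈-outs⁻ (A G) w∈)) cv))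

    CEq-R : ∀ v j → c′ v ≡ just j → RIn G v ≢ [] → msum c′ (RIn G v) ≡ just j
    CEq-R v j c′v ne with map-just⁻ (c v) c′v
    ... | _ , cv , refl = trans (msum-just c′ d (RIn G v) defined) (cong just (sum-d-RIn cv ne))
      where
      defined : ∀ {y} → y ∈ RIn G v → c′ y ≡ just (d y)
      defined y∈ = c′-just (proj₂ (defined-parent (inj₁ (∈-ins⁻ (R G) y∈)) cv))

  agglomerate : ∃[ c′ ] (IsConfig G c′ × WellDefined G c′ × c′ p ≡ just k
                         × (∀ q → q ∈ AOut G p → c′ q ≡ just (l q))
                         × AgreeOffSuccs G p c′ c)
  agglomerate = c′ , c′-isConfig , c′-wellDefined , trans (c′-just cp) (cong just d-source)
              , targets , λ _ _ ¬p⟶⋆v → c′-unchanged (d-outside ¬p⟶⋆v)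
    where
    targets : ∀ q → q ∈ AOut G p → c′ q ≡ just (l q)
    targets q q∈ = trans (c′-just (proj₂ (defined-child (inj₂ pq) cp))) (cong just (d-target pq))
      where pq = ∈-outs⁻ (A G) q∈

-- Forward

module Forward
  (G : TFG) (acyclic : Acyclic G)
  (T2  : ∀ v → InV G v → IsConst v → ∀ u → ¬ (G ⊢ u ⟶ v))
  (T3a : ∀ p p' q → G ⊢ p ∘→ q → G ⊢ p' ⟶ q → p ≡ p')
  (T3b : ∀ p q → G ⊢ p →• q → ¬ (G ⊢ p ∘→ q))
  where

  Pushed : Config → Sym → Sym → ℕ → Set
  Pushed c p q k = ∃[ c′ ] (IsConfig G c′ × WellDefined G c′
                            × c′ p ≡ just k × (∃[ j ] (c′ q ≡ just j × k ≤ j))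
                            × AgreeOffSuccs G p c′ c)

  push-through : ∀ {c c₁ p r q k k′} → InV G p → G ⊢ p ⟶ r → c₁ p ≡ just k → k ≤ k′ →
                 AgreeOffSuccs G p c₁ c → Pushed c₁ r q k′ → Pushed c p q k
  push-through {p = p} p∈V pr c₁p k≤k′ same₁ (c₂ , ic₂ , wd₂ , _ , (j , c₂q , k′≤j) , same₂) =
    c₂ , ic₂ , wd₂ , trans (same₂ p p∈V (acyclic p _ pr)) c₁p , (j , c₂q , ≤-trans k≤k′ k′≤j)
    , λ v v∈V ¬p⟶⋆v → trans (same₂ v v∈V (¬p⟶⋆v ∘ there pr)) (same₁ v v∈V ¬p⟶⋆v)

  forward : ∀ {p q} → G ⊢ p ⟶⋆ q → ∀ {c k} → IsConfig G c → WellDefined G c → c p ≡ just k →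
            Pushed c p q k
  forward here isConfig wd cp = _ , isConfig , wd , cp , (_ , cp , ≤-refl) , λ _ _ _ → refl
  forward (there (inj₁ pr) s) isConfig wd cp
    with WellDefinedConfig.defined-child wd (inj₁ pr) cp
  ... | _ , cr = push-through (config⇒InV isConfig cp) (inj₁ pr) cp
                   (WellDefinedConfig.R-parent-≤ wd pr cp cr) (λ _ _ _ → refl)
                   (forward s isConfig wd cr)
  forward {p} (there {v = r} (inj₂ pr) s) {k = k} isConfig wd cp
    with Agglomeration.agglomerate G acyclic T2 T3a T3b isConfig wd cp (point r k)
           (sum-point-∈ k (outs-unique (A G) p (A-unique G)) (∈-outs⁺ (A G) pr))
  ... | _ , isConfig₁ , wd₁ , c₁p , c₁targets , same₁ =
    push-through (config⇒InV isConfig cp) (inj₂ pr) c₁p ≤-refl same₁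
      (forward s isConfig₁ wd₁ (trans (c₁targets r (∈-outs⁺ (A G) pr)) (cong just (point-self r k))))

lemma2 : (N₁ N₂ : Net) (m₁ : Marking N₁) (m₂ : Marking N₂) (E : System) (G : TFG) (c : Config)
    → EEquiv N₁ m₁ E N₂ m₂
    → WellFormed G N₁ N₂ E
    → Acyclic G
    → IsConfig G c
    → WellDefined G c
    -- (Forward)
    → (∀ p q k → InV G p → InV G q → c p ≡ just k → G ⊢ p ⟶⋆ q
        → ∃[ c' ] (IsConfig G c' × WellDefined G c'
                   × c' p ≡ just k × (∃[ j ] (c' q ≡ just j × k ≤ j))
                   × (∀ v → InV G v → ¬ (G ⊢ p ⟶⋆ v) → c' v ≡ c v)))
    -- (Backward)
    × (∀ p k → c p ≡ just k → 0 < k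
        → ∃[ v ] (IsRoot G v × G ⊢ v ⟶⋆ p × ∃[ j ] (c v ≡ just j × 0 < j)))
    -- (Agglomeration)
    × (∀ p k → c p ≡ just k → AOut G p ≢ []
        → (l : Sym → ℕ) → sum (map l (AOut G p)) ≡ k
        → ∃[ c' ] (IsConfig G c' × WellDefined G c'
                   × c' p ≡ just k
                   × (∀ q → q ∈ AOut G p → c' q ≡ just (l q))
                   × (∀ v → InV G v → ¬ (G ⊢ p ⟶⋆ v) → c' v ≡ c v)))
lemma2 _ _ _ _ _ G _ _ wf acyclic isConfig wd =
    (λ _ _ _ _ _ cp p⟶⋆q → Forward.forward G acyclic T2 T3a T3b p⟶⋆q isConfig wd cp)
  , (λ p _ cp pos → positive⇒fedByRoot isConfig wd (⟶-wellFounded acyclic p) cp pos)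
  , (λ _ _ cp _ l sum-l → Agglomeration.agglomerate G acyclic T2 T3a T3b isConfig wd cp l sum-l)
  where open WellFormed wf
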